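{- The vertex set of every regular simplex (in some Euclidean space) is diameter-Ramsey.
   Context: A regular simplex is a set of affinely independent points all of whose pairwise distances are equal. For a finite set $X$, $\mathrm{diam}(X)$ denotes the largest Euclidean distance between two points of $X$. Two point sets are congruent if there is an isometry mapping one onto the other. A finite set $P$ of points in a Euclidean space is called diameter-Ramsey if for every integer $r\ge 2$ there exist an integer $d=d(P,r)$ and a finite set $R\subset\mathbb{R}^d$ with $\mathrm{diam}(R)=\mathrm{diam}(P)$ such that for every coloring of the points of $R$ with $r$ colors there is a monochromatic subset of $R$ congruent to $P$. -}

module Defs where

open import Data.Nat using (ℕ; zero; suc)
import Data.Nat as Nat
open import Data.Fin using (Fin)
import Data.Fin as Fin
open import Data.Product using (Σ; ∃; ∃-syntax; _×_; _,_)
open import Data.Sum using (_⊎_)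
open import Data.Empty using (⊥)
open import Relation.Nullary using (¬_)
open import Relation.Binary.PropositionalEquality using (_≡_)
open import Function.Definitions using (Injective)

-- The real numbers, axiomatised as a Dedekind-complete ordered field
-- (categorical, so any model is isomorphic to ℝ).
record RealField : Set₁ where
  infixl 6 _+_
  infixl 7 _*_
  infix 4 _<_ _≤_
  field
    Carrier : Set
    0# 1# : Carrier
    _+_ _*_ : Carrier → Carrier → Carrier
    -_ : Carrier → Carrier
    _<_ : Carrier → Carrier → Set
    +-assoc : ∀ x y z → (x + y) + z ≡ x + (y + z)
    +-comm : ∀ x y → x + y ≡ y + x
    +-identityˡ : ∀ x → 0# + x ≡ x
    -‿inverseˡ : ∀ x → (- x) + x ≡ 0#
    *-assoc : ∀ x y z → (x * y) * z ≡ x * (y * z)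
    *-comm : ∀ x y → x * y ≡ y * x
    *-identityˡ : ∀ x → 1# * x ≡ x
    distribˡ : ∀ x y z → x * (y + z) ≡ (x * y) + (x * z)
    0≢1 : ¬ (0# ≡ 1#)
    *-inverse : ∀ x → ¬ (x ≡ 0#) → ∃[ y ] (x * y ≡ 1#)
    <-irrefl : ∀ x → ¬ (x < x)
    <-trans : ∀ x y z → x < y → y < z → x < z
    <-trichotomy : ∀ x y → (x < y) ⊎ ((x ≡ y) ⊎ (y < x))
    +-mono-< : ∀ x y z → x < y → x + z < y + z
    *-pos : ∀ x y → 0# < x → 0# < y → 0# < x * y

  _≤_ : Carrier → Carrier → Set
  x ≤ y = (x < y) ⊎ (x ≡ y)

  _-_ : Carrier → Carrier → Carrier
  x - y = x + (- y)

  field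
    completeness : (S : Carrier → Set) → ∃[ x ] S x →
      ∃[ b ] (∀ x → S x → x ≤ b) →
      ∃[ u ] ((∀ x → S x → x ≤ u) × (∀ b → (∀ x → S x → x ≤ b) → u ≤ b))

module Euclid (ℝ : RealField) where
  open RealField ℝ

  Point : ℕ → Set
  Point d = Fin d → Carrier

  _≈ₚ_ : ∀ {d} → Point d → Point d → Set
  x ≈ₚ y = ∀ t → x t ≡ y t

  ∑ : ∀ {m} → (Fin m → Carrier) → Carrier
  ∑ {zero} f = 0#
  ∑ {suc m} f = f Fin.zero + ∑ (λ i → f (Fin.suc i))

  sqDist : ∀ {d} → Point d → Point d → Carrier
  sqDist x y = ∑ (λ t → (x t - y t) * (x t - y t))

  IsSqDiam : ∀ {d m} → (Fin m → Point d) → Carrier → Set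
  IsSqDiam x D = (∀ i j → sqDist (x i) (x j) ≤ D) × ∃[ i ] ∃[ j ] (sqDist (x i) (x j) ≡ D)

  AffinelyIndependent : ∀ {d m} → (Fin m → Point d) → Set
  AffinelyIndependent {d} {m} p =
    (c : Fin m → Carrier) → ∑ c ≡ 0# → (∀ t → ∑ (λ i → c i * p i t) ≡ 0#) → ∀ i → c i ≡ 0#

  RegularSimplex : ∀ {d k} → (Fin (suc k) → Point d) → Set
  RegularSimplex p = AffinelyIndependent p ×
    ∃[ s ] (∀ i j → ¬ (i ≡ j) → sqDist (p i) (p j) ≡ s)

  RamseyFor : ∀ {n m d N} (p : Fin m → Point n) (e : Fin N → Point d) (r : ℕ) → Set
  RamseyFor {n} {m} {d} {N} p e r = (χ : Fin N → Fin r) →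
    ∃[ f ] (Injective _≡_ _≡_ f × (∀ i j → χ (f i) ≡ χ (f j)) ×
            (∀ i j → sqDist (e (f i)) (e (f j)) ≡ sqDist (p i) (p j)))

  DiameterRamsey : ∀ {n m} → (Fin m → Point n) → Set
  DiameterRamsey {n} {m} p = (r : ℕ) → 2 Nat.≤ r →
    ∃[ d ] ∃[ N ] Σ (Fin N → Point d) λ e →
      Injective _≡_ _≈ₚ_ e ×
      ∃[ D ] (IsSqDiam p D × IsSqDiam e D) ×
      RamseyFor p e r

-- The standard basis vectors of ℝᴺ form a regular simplex with squared side 2; tensoring them
-- with a vector of squared norm s/2 gives, for every N, a regular simplex with N vertices and
-- squared side s, hence with the same diameter as a given regular simplex of squared side s.
-- Without square roots, such a vector is (½, ½) ⊗ (p₀ - p₁). If the given simplex has m vertices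
-- and N = r(m - 1) + 1, the pigeonhole principle yields m vertices of the large simplex of the
-- same colour, and any m of its vertices are congruent to the m vertices of the given one.

module Submission where

open import Defs
open import Data.Nat as ℕ using (ℕ; zero; suc; s≤s)
open import Data.Nat.Properties using (n<1+n)
open import Data.Fin using (Fin; zero; suc; _≟_; _↑ˡ_; _↑ʳ_; combine; remQuot)
open import Data.Fin.Properties using (remQuot-combine)
open import Data.Product using (Σ; ∃-syntax; _×_; _,_; proj₁; proj₂; uncurry)
open import Data.Sum using (_⊎_; inj₁; inj₂)
open import Data.Empty using (⊥-elim)
open import Function using (_∘_)
open import Function.Definitions using (Injective)
open import Algebra.Bundles using (CommutativeRing)
open import Relation.Nullary using (¬_; yes; no)
open import Relation.Binary.PropositionalEquality
  using (_≡_; _≢_; refl; sym; trans; cong; cong₂; subst; subst₂; isEquivalence; module ≡-Reasoning)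

module Pigeonhole where

  open import Data.Nat using (_+_; _*_; _<_; _<?_)
  open import Data.Nat.Properties using (+-suc; ≮⇒≥; +-monoˡ-≤; +-cancelˡ-<; module ≤-Reasoning)
  open import Data.Fin using (inject≤)
  open import Data.Fin.Properties using (inject≤-injective)
  open import Data.List using (List; []; _∷_; length; filter; allFin; lookup)
  open import Data.List.Properties using (length-tabulate)
  open import Data.List.Membership.Propositional using (_∈_)
  open import Data.List.Membership.Propositional.Properties using (∈-lookup; ∈-allFin)
  open import Data.List.Relation.Unary.Any using (here; there)
  open import Data.List.Relation.Unary.All as All using (All; []; _∷_)
  open import Data.List.Relation.Unary.All.Properties using (all-filter; tabulate⁺)
    renaming (filter⁺ to All-filter⁺)
  open import Data.List.Relation.Unary.AllPairs using (_∷_)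
  open import Data.List.Relation.Unary.Unique.Propositional using (Unique)
  open import Data.List.Relation.Unary.Unique.Propositional.Properties using (allFin⁺)
    renaming (filter⁺ to Unique-filter⁺)
  open import Level using (0ℓ)
  open import Relation.Unary using (Pred; Decidable)
  open import Relation.Unary.Properties using (∁?)
  open import Relation.Binary.Definitions using (DecidableEquality)

  length-filter-∁ : ∀ {A : Set} {P : Pred A 0ℓ} (P? : Decidable P) xs →
    length (filter P? xs) + length (filter (∁? P?) xs) ≡ length xs
  length-filter-∁ P? [] = refl
  length-filter-∁ P? (x ∷ xs) with P? x
  ... | yes _ = cong suc (length-filter-∁ P? xs)
  ... | no _ = trans (+-suc _ _) (cong suc (length-filter-∁ P? xs))

  lookup-injective : ∀ {A : Set} {xs : List A} → Unique xs → ∀ {i j} →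
    lookup xs i ≡ lookup xs j → i ≡ j
  lookup-injective (_ ∷ _) {zero} {zero} _ = refl
  lookup-injective (x≢ ∷ _) {zero} {suc j} eq = ⊥-elim (All.lookup x≢ (∈-lookup j) eq)
  lookup-injective (x≢ ∷ _) {suc i} {zero} eq = ⊥-elim (All.lookup x≢ (∈-lookup i) (sym eq))
  lookup-injective (_ ∷ u) {suc i} {suc j} eq = cong suc (lookup-injective u eq)

  module _ {A C : Set} (_≟_ : DecidableEquality C) (colour : A → C) (K : ℕ) where

    hasColour? : (c : C) → Decidable (λ x → colour x ≡ c)
    hasColour? c x = colour x ≟ c

    monochromatic-sublist : (cs : List C) (xs : List A) →
      Unique xs → All (λ x → colour x ∈ cs) xs → length cs * K < length xs →
      ∃[ c ] ∃[ ys ] Unique ys × All (λ y → colour y ≡ c) ys × K < length ys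
    monochromatic-sublist [] (x ∷ _) _ (() ∷ _) _
    monochromatic-sublist (c ∷ cs) xs xs! xs∈ size with K <? length (filter (hasColour? c) xs)
    ... | yes big = c , _ , Unique-filter⁺ (hasColour? c) xs! , all-filter (hasColour? c) xs , big
    ... | no small = monochromatic-sublist cs (filter (∁? (hasColour? c)) xs)
            (Unique-filter⁺ (∁? (hasColour? c)) xs!)
            (All.zipWith drop-c
              (All-filter⁺ (∁? (hasColour? c)) xs∈ , all-filter (∁? (hasColour? c)) xs))
            size′
      where
      drop-c : ∀ {x} → colour x ∈ c ∷ cs × ¬ colour x ≡ c → colour x ∈ cs
      drop-c (here eq , ≢c) = ⊥-elim (≢c eq)
      drop-c (there ∈cs , _) = ∈cs
      size′ : length cs * K < length (filter (∁? (hasColour? c)) xs)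
      size′ = +-cancelˡ-< K _ _ (begin-strict
        K + length cs * K                                  <⟨ size ⟩
        length xs                                          ≡⟨ length-filter-∁ (hasColour? c) xs ⟨
        length (filter (hasColour? c) xs) + length others  ≤⟨ +-monoˡ-≤ (length others) (≮⇒≥ small) ⟩
        K + length others                                  ∎)
        where
        open ≤-Reasoning
        others = filter (∁? (hasColour? c)) xs

  pigeonhole : ∀ {N r} K (χ : Fin N → Fin r) → r * K < N →
    Σ (Fin (suc K) → Fin N) λ f → Injective _≡_ _≡_ f × (∀ i j → χ (f i) ≡ χ (f j))
  pigeonhole {N} {r} K χ size
    with c , ys , ys! , mono , long ←
           monochromatic-sublist _≟_ χ K (allFin r) (allFin N) (allFin⁺ N)
             (tabulate⁺ (λ i → ∈-allFin (χ i)))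
             (subst₂ (λ a b → a * K < b)
               (sym (length-tabulate {n = r} _)) (sym (length-tabulate {n = N} _)) size)
    = f , inject≤-injective long long _ _ ∘ lookup-injective ys! ,
      λ i j → trans (colour-f i) (sym (colour-f j))
    where
    f : Fin (suc K) → Fin N
    f i = lookup ys (inject≤ i long)
    colour-f : ∀ i → χ (f i) ≡ c
    colour-f i = All.lookup mono (∈-lookup _)

open Pigeonhole using (pigeonhole)

module _ (ℝ : RealField) where
  open RealField ℝ
  open Euclid ℝ

  commutativeRing : CommutativeRing _ _
  commutativeRing = record
    { Carrier = Carrier ; _≈_ = _≡_ ; _+_ = _+_ ; _*_ = _*_ ; -_ = -_ ; 0# = 0# ; 1# = 1#
    ; isCommutativeRing = record
      { isRing = record
        { +-isAbelianGroup = record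
          { isGroup = record
            { isMonoid = record
              { isSemigroup = record
                { isMagma = record { isEquivalence = isEquivalence ; ∙-cong = cong₂ _+_ }
                ; assoc = +-assoc }
              ; identity = +-identityˡ , λ x → trans (+-comm x 0#) (+-identityˡ x) }
            ; inverse = -‿inverseˡ , λ x → trans (+-comm x (- x)) (-‿inverseˡ x)
            ; ⁻¹-cong = cong (-_) }
          ; comm = +-comm }
        ; *-cong = cong₂ _*_
        ; *-assoc = *-assoc
        ; *-identity = *-identityˡ , λ x → trans (*-comm x 1#) (*-identityˡ x)
        ; distrib = distribˡ , λ x y z → trans (*-comm (y + z) x)
                      (trans (distribˡ x y z) (cong₂ _+_ (*-comm x y) (*-comm x z))) }
      ; *-comm = *-comm } }

  open CommutativeRing commutativeRing
    using (+-identityʳ; *-identityʳ; zeroˡ; zeroʳ; -‿inverseʳ; distribʳ; ring;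
           +-commutativeSemigroup; *-commutativeSemigroup)
  open import Algebra.Properties.Ring ring
    using (-‿distribˡ-*; -‿distribʳ-*; -‿involutive; -0#≈0#; [y-z]x≈yx-zx;
           ⁻¹-anti-homo‿-; -‿+-comm; x∙y⁻¹≈ε⇒x≈y)
  open import Algebra.Properties.CommutativeSemigroup +-commutativeSemigroup
    using () renaming (interchange to +-interchange)
  open import Algebra.Properties.CommutativeSemigroup *-commutativeSemigroup
    using () renaming (interchange to *-interchange)

  x-0≡x : ∀ x → x - 0# ≡ x
  x-0≡x x = trans (cong (x +_) -0#≈0#) (+-identityʳ x)

  -x*-x≡x*x : ∀ x → (- x) * (- x) ≡ x * x
  -x*-x≡x*x x = begin
    (- x) * (- x)  ≡⟨ -‿distribˡ-* x (- x) ⟨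
    - (x * - x)    ≡⟨ cong -_ (-‿distribʳ-* x x) ⟨
    - - (x * x)    ≡⟨ -‿involutive (x * x) ⟩
    x * x          ∎
    where open ≡-Reasoning

  0-x*0-x≡x*x : ∀ x → (0# - x) * (0# - x) ≡ x * x
  0-x*0-x≡x*x x = trans (cong (λ y → y * y) (+-identityˡ (- x))) (-x*-x≡x*x x)

  <⇒≢ : ∀ {x y} → x < y → x ≢ y
  <⇒≢ {x} x<y refl = <-irrefl x x<y

  0<-x : ∀ {x} → x < 0# → 0# < - x
  0<-x {x} x<0 = subst₂ _<_ (-‿inverseʳ x) (+-identityˡ (- x)) (+-mono-< x 0# (- x) x<0)

  0<x*x : ∀ {x} → x < 0# ⊎ 0# < x → 0# < x * x
  0<x*x (inj₁ x<0) = subst (0# <_) (-x*-x≡x*x _) (*-pos _ _ (0<-x x<0) (0<-x x<0))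
  0<x*x (inj₂ 0<x) = *-pos _ _ 0<x 0<x

  0≤x*x : ∀ x → 0# ≤ x * x
  0≤x*x x with <-trichotomy x 0#
  ... | inj₁ x<0 = inj₁ (0<x*x (inj₁ x<0))
  ... | inj₂ (inj₁ refl) = inj₂ (sym (zeroˡ 0#))
  ... | inj₂ (inj₂ 0<x) = inj₁ (0<x*x (inj₂ 0<x))

  x*x≡0⇒x≡0 : ∀ {x} → x * x ≡ 0# → x ≡ 0#
  x*x≡0⇒x≡0 {x} x*x≡0 with <-trichotomy x 0#
  ... | inj₁ x<0 = ⊥-elim (<⇒≢ (0<x*x (inj₁ x<0)) (sym x*x≡0))
  ... | inj₂ (inj₁ x≡0) = x≡0
  ... | inj₂ (inj₂ 0<x) = ⊥-elim (<⇒≢ (0<x*x (inj₂ 0<x)) (sym x*x≡0))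

  0<1 : 0# < 1#
  0<1 with <-trichotomy 1# 0#
  ... | inj₁ 1<0 = subst (0# <_) (*-identityˡ 1#) (0<x*x (inj₁ 1<0))
  ... | inj₂ (inj₁ 1≡0) = ⊥-elim (0≢1 (sym 1≡0))
  ... | inj₂ (inj₂ 0<1) = 0<1

  0<+ : ∀ {x y} → 0# < x → 0# ≤ y → 0# < x + y
  0<+ {x} 0<x (inj₂ refl) = subst (0# <_) (sym (+-identityʳ x)) 0<x
  0<+ {x} {y} 0<x (inj₁ 0<y) =
    <-trans _ _ _ 0<y (subst (_< x + y) (+-identityˡ y) (+-mono-< 0# x y 0<x))

  0≤+ : ∀ {x y} → 0# ≤ x → 0# ≤ y → 0# ≤ x + y
  0≤+ (inj₁ 0<x) 0≤y = inj₁ (0<+ 0<x 0≤y)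
  0≤+ {y = y} (inj₂ refl) 0≤y = subst (0# ≤_) (sym (+-identityˡ y)) 0≤y

  +-nonneg≡0 : ∀ {x y} → 0# ≤ x → 0# ≤ y → x + y ≡ 0# → x ≡ 0# × y ≡ 0#
  +-nonneg≡0 (inj₁ 0<x) 0≤y x+y≡0 = ⊥-elim (<⇒≢ (0<+ 0<x 0≤y) (sym x+y≡0))
  +-nonneg≡0 {y = y} (inj₂ refl) _ x+y≡0 = refl , trans (sym (+-identityˡ y)) x+y≡0

  1+1≢0 : 1# + 1# ≢ 0#
  1+1≢0 = <⇒≢ (0<+ 0<1 (inj₁ 0<1)) ∘ sym

  ∑-cong : ∀ {m} {f g : Fin m → Carrier} → (∀ i → f i ≡ g i) → ∑ f ≡ ∑ g
  ∑-cong {zero} _ = refl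
  ∑-cong {suc m} f≡g = cong₂ _+_ (f≡g zero) (∑-cong (f≡g ∘ suc))

  ∑-zero : ∀ {m} {f : Fin m → Carrier} → (∀ i → f i ≡ 0#) → ∑ f ≡ 0#
  ∑-zero {zero} _ = refl
  ∑-zero {suc m} f≡0 = trans (cong₂ _+_ (f≡0 zero) (∑-zero (f≡0 ∘ suc))) (+-identityˡ 0#)

  ∑-distrib-+ : ∀ {m} (f g : Fin m → Carrier) → ∑ (λ i → f i + g i) ≡ ∑ f + ∑ g
  ∑-distrib-+ {zero} _ _ = sym (+-identityˡ 0#)
  ∑-distrib-+ {suc m} f g =
    trans (cong (f zero + g zero +_) (∑-distrib-+ (f ∘ suc) (g ∘ suc))) (+-interchange _ _ _ _)

  ∑-neg : ∀ {m} (f : Fin m → Carrier) → ∑ (λ i → - f i) ≡ - ∑ f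
  ∑-neg {zero} _ = sym -0#≈0#
  ∑-neg {suc m} f = trans (cong (- f zero +_) (∑-neg (f ∘ suc))) (-‿+-comm _ _)

  ∑-distrib-- : ∀ {m} (f g : Fin m → Carrier) → ∑ (λ i → f i - g i) ≡ ∑ f - ∑ g
  ∑-distrib-- f g = trans (∑-distrib-+ f (-_ ∘ g)) (cong (∑ f +_) (∑-neg g))

  ∑-*ˡ : ∀ {m} c (f : Fin m → Carrier) → ∑ (λ i → c * f i) ≡ c * ∑ f
  ∑-*ˡ {zero} c _ = sym (zeroʳ c)
  ∑-*ˡ {suc m} c f = trans (cong (c * f zero +_) (∑-*ˡ c (f ∘ suc))) (sym (distribˡ c _ _))

  ∑-*ʳ : ∀ {m} c (f : Fin m → Carrier) → ∑ (λ i → f i * c) ≡ ∑ f * c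
  ∑-*ʳ c f = trans (∑-cong (λ i → *-comm (f i) c)) (trans (∑-*ˡ c f) (*-comm c (∑ f)))

  ∑-splitAt : ∀ m {n} (f : Fin (m ℕ.+ n) → Carrier) →
    ∑ f ≡ ∑ (λ i → f (i ↑ˡ n)) + ∑ (λ i → f (m ↑ʳ i))
  ∑-splitAt zero f = sym (+-identityˡ _)
  ∑-splitAt (suc m) f = trans (cong (f zero +_) (∑-splitAt m (f ∘ suc))) (sym (+-assoc _ _ _))

  ∑-combine : ∀ m n (f : Fin (m ℕ.* n) → Carrier) →
    ∑ f ≡ ∑ {m} (λ a → ∑ {n} (λ b → f (combine a b)))
  ∑-combine zero n f = refl
  ∑-combine (suc m) n f = trans (∑-splitAt n f) (cong (∑ (λ b → f (b ↑ˡ (m ℕ.* n))) +_)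
    (∑-combine m n (λ t → f (n ↑ʳ t))))

  ∑-nonneg : ∀ {m} {f : Fin m → Carrier} → (∀ i → 0# ≤ f i) → 0# ≤ ∑ f
  ∑-nonneg {zero} _ = inj₂ refl
  ∑-nonneg {suc m} f≥0 = 0≤+ (f≥0 zero) (∑-nonneg (f≥0 ∘ suc))

  ∑-nonneg≡0 : ∀ {m} {f : Fin m → Carrier} → (∀ i → 0# ≤ f i) → ∑ f ≡ 0# → ∀ i → f i ≡ 0#
  ∑-nonneg≡0 {suc m} f≥0 ∑≡0 i with +-nonneg≡0 (f≥0 zero) (∑-nonneg (f≥0 ∘ suc)) ∑≡0 | i
  ... | head≡0 , _ | zero = head≡0
  ... | _ , tail≡0 | suc i = ∑-nonneg≡0 (f≥0 ∘ suc) tail≡0 i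

  sqNorm : ∀ {d} → Point d → Carrier
  sqNorm x = ∑ (λ t → x t * x t)

  sqNorm-nonneg : ∀ {d} (x : Point d) → 0# ≤ sqNorm x
  sqNorm-nonneg x = ∑-nonneg (λ t → 0≤x*x (x t))

  ≈ₚ⇒sqDist≡0 : ∀ {d} {x y : Point d} → x ≈ₚ y → sqDist x y ≡ 0#
  ≈ₚ⇒sqDist≡0 {x = x} x≈y = ∑-zero λ t → begin
    (x t - _) * (x t - _)    ≡⟨ cong (λ z → (x t - z) * (x t - z)) (x≈y t) ⟨
    (x t - x t) * (x t - x t) ≡⟨ cong (λ z → z * z) (-‿inverseʳ (x t)) ⟩
    0# * 0#                   ≡⟨ zeroˡ 0# ⟩
    0#                        ∎
    where open ≡-Reasoning

  sqDist-self : ∀ {d} (x : Point d) → sqDist x x ≡ 0#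
  sqDist-self x = ≈ₚ⇒sqDist≡0 {x = x} {x} (λ _ → refl)

  sqDist≡0⇒≈ₚ : ∀ {d} {x y : Point d} → sqDist x y ≡ 0# → x ≈ₚ y
  sqDist≡0⇒≈ₚ {x = x} {y} d≡0 t =
    x∙y⁻¹≈ε⇒x≈y (x t) (y t) (x*x≡0⇒x≡0 (∑-nonneg≡0 (λ t → 0≤x*x (x t - y t)) d≡0 t))

  sqDist-sym : ∀ {d} (x y : Point d) → sqDist x y ≡ sqDist y x
  sqDist-sym {d} x y = ∑-cong {d} λ t → trans (sym (-x*-x≡x*x (x t - y t)))
    (cong (λ z → z * z) (⁻¹-anti-homo‿- (x t) (y t)))

  infixl 7 _⊗_
  _⊗_ : ∀ {m n} → Point m → Point n → Point (m ℕ.* n)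
  _⊗_ {n = n} x y t = uncurry (λ a b → x a * y b) (remQuot n t)

  ⊗-combine : ∀ {m n} (x : Point m) (y : Point n) a b → (x ⊗ y) (combine a b) ≡ x a * y b
  ⊗-combine x y a b = cong (uncurry (λ a b → x a * y b)) (remQuot-combine a b)

  sqNorm-⊗ : ∀ {m n} (x : Point m) (y : Point n) → sqNorm (x ⊗ y) ≡ sqNorm x * sqNorm y
  sqNorm-⊗ {m} {n} x y = begin
    sqNorm (x ⊗ y)                                    ≡⟨ ∑-combine m n _ ⟩
    ∑ {m} (λ a → ∑ {n} (λ b → (x ⊗ y) (combine a b) * (x ⊗ y) (combine a b)))
      ≡⟨ ∑-cong {m} (λ a → ∑-cong {n} (λ b → cong (λ z → z * z) (⊗-combine x y a b))) ⟩
    ∑ {m} (λ a → ∑ {n} (λ b → (x a * y b) * (x a * y b)))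
      ≡⟨ ∑-cong {m} (λ a → ∑-cong {n} (λ b → *-interchange (x a) (y b) (x a) (y b))) ⟩
    ∑ {m} (λ a → ∑ {n} (λ b → (x a * x a) * (y b * y b)))
      ≡⟨ ∑-cong {m} (λ a → ∑-*ˡ (x a * x a) (λ b → y b * y b)) ⟩
    ∑ {m} (λ a → (x a * x a) * sqNorm y)             ≡⟨ ∑-*ʳ (sqNorm y) (λ a → x a * x a) ⟩
    sqNorm x * sqNorm y                               ∎
    where open ≡-Reasoning

  sqDist-⊗ʳ : ∀ {m n} (x y : Point m) (z : Point n) →
    sqDist (x ⊗ z) (y ⊗ z) ≡ sqDist x y * sqNorm z
  sqDist-⊗ʳ {m} {n} x y z =
    trans (∑-cong {m ℕ.* n} λ t → cong (λ w → w * w) (sym ([y-z]x≈yx-zx _ _ _)))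
      (sqNorm-⊗ (λ a → x a - y a) z)

  basis : ∀ {N} → Fin N → Point N
  basis zero zero = 1#
  basis zero (suc _) = 0#
  basis (suc _) zero = 0#
  basis (suc i) (suc a) = basis i a

  basis-diag : ∀ {N} (i : Fin N) → basis i i ≡ 1#
  basis-diag zero = refl
  basis-diag (suc i) = basis-diag i

  basis-≢ : ∀ {N} {i j : Fin N} → i ≢ j → basis i j ≡ 0#
  basis-≢ {i = zero} {zero} i≢j = ⊥-elim (i≢j refl)
  basis-≢ {i = zero} {suc j} _ = refl
  basis-≢ {i = suc i} {zero} _ = refl
  basis-≢ {i = suc i} {suc j} i≢j = basis-≢ (i≢j ∘ cong suc)

  ∑-basis-* : ∀ {N} (i : Fin N) (x : Fin N → Carrier) → ∑ (λ a → basis i a * x a) ≡ x i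
  ∑-basis-* zero x = trans
    (cong₂ _+_ (*-identityˡ (x zero)) (∑-zero (λ a → zeroˡ (x (suc a)))))
    (+-identityʳ (x zero))
  ∑-basis-* (suc i) x = trans (cong₂ _+_ (zeroˡ (x zero)) (∑-basis-* i (x ∘ suc))) (+-identityˡ _)

  ∑-basis : ∀ {N} (i : Fin N) → ∑ (basis i) ≡ 1#
  ∑-basis i = trans (∑-cong (λ a → sym (*-identityʳ (basis i a)))) (∑-basis-* i (λ _ → 1#))

  sqNorm-basis : ∀ {N} (i : Fin N) → sqNorm (basis i) ≡ 1#
  sqNorm-basis i = trans (∑-basis-* i (basis i)) (basis-diag i)

  sqDist-basis : ∀ {N} {i j : Fin N} → i ≢ j → sqDist (basis i) (basis j) ≡ 1# + 1#
  sqDist-basis {i = zero} {zero} i≢j = ⊥-elim (i≢j refl)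
  sqDist-basis {i = zero} {suc j} _ = cong₂ _+_
    (trans (cong (λ z → z * z) (x-0≡x 1#)) (*-identityˡ 1#))
    (trans (∑-cong (λ a → 0-x*0-x≡x*x (basis j a))) (sqNorm-basis j))
  sqDist-basis {i = suc i} {zero} _ =
    trans (sqDist-sym (basis (suc i)) (basis zero)) (sqDist-basis {i = zero} {suc i} λ ())
  sqDist-basis {i = suc i} {suc j} i≢j =
    trans (cong₂ _+_ (trans (0-x*0-x≡x*x 0#) (zeroˡ 0#)) (sqDist-basis (i≢j ∘ cong suc)))
      (+-identityˡ _)

  affinelyIndependent⇒injective : ∀ {d m} {p : Fin m → Point d} →
    AffinelyIndependent p → Injective _≡_ _≈ₚ_ p
  affinelyIndependent⇒injective {m = m} {p = p} indep {i} {j} pi≈pj with i ≟ j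
  ... | yes i≡j = i≡j
  ... | no i≢j = ⊥-elim (0≢1 (trans (sym (indep c ∑c≡0 ∑cp≡0 i)) cᵢ≡1))
    where
    c : Fin _ → Carrier
    c a = basis i a - basis j a
    cᵢ≡1 : c i ≡ 1#
    cᵢ≡1 = trans (cong₂ _-_ (basis-diag i) (basis-≢ (i≢j ∘ sym))) (x-0≡x 1#)
    ∑c≡0 : ∑ c ≡ 0#
    ∑c≡0 = trans (∑-distrib-- (basis i) (basis j))
      (trans (cong₂ _-_ (∑-basis i) (∑-basis j)) (-‿inverseʳ 1#))
    ∑cp≡0 : ∀ t → ∑ (λ a → c a * p a t) ≡ 0#
    ∑cp≡0 t = begin
      ∑ (λ a → c a * p a t)
        ≡⟨ ∑-cong {m} (λ a → [y-z]x≈yx-zx (p a t) _ _) ⟩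
      ∑ (λ a → (basis i a * p a t) - (basis j a * p a t))
        ≡⟨ ∑-distrib-- (λ a → basis i a * p a t) (λ a → basis j a * p a t) ⟩
      ∑ (λ a → basis i a * p a t) - ∑ (λ a → basis j a * p a t)
        ≡⟨ cong₂ _-_ (∑-basis-* i (λ a → p a t)) (∑-basis-* j (λ a → p a t)) ⟩
      p i t - p j t
        ≡⟨ cong (λ z → p i t - z) (pi≈pj t) ⟨
      p i t - p i t
        ≡⟨ -‿inverseʳ (p i t) ⟩
      0#
        ∎
      where open ≡-Reasoning

  ½ : Carrier
  ½ = proj₁ (*-inverse (1# + 1#) 1+1≢0)

  2*½≡1 : (1# + 1#) * ½ ≡ 1#
  2*½≡1 = proj₂ (*-inverse (1# + 1#) 1+1≢0)

  ½+½≡1 : ½ + ½ ≡ 1#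
  ½+½≡1 = begin
    ½ + ½               ≡⟨ cong₂ _+_ (*-identityˡ ½) (*-identityˡ ½) ⟨
    1# * ½ + 1# * ½     ≡⟨ distribʳ ½ 1# 1# ⟨
    (1# + 1#) * ½       ≡⟨ 2*½≡1 ⟩
    1#                  ∎
    where open ≡-Reasoning

  halves : Point 2
  halves _ = ½

  sqNorm-halves : sqNorm halves ≡ ½
  sqNorm-halves = begin
    ½ * ½ + (½ * ½ + 0#)  ≡⟨ cong (½ * ½ +_) (+-identityʳ (½ * ½)) ⟩
    ½ * ½ + ½ * ½         ≡⟨ distribˡ ½ ½ ½ ⟨
    ½ * (½ + ½)           ≡⟨ cong (½ *_) ½+½≡1 ⟩
    ½ * 1#                ≡⟨ *-identityʳ ½ ⟩
    ½                     ∎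
    where open ≡-Reasoning

  Equidistant : ∀ {d m} → (Fin m → Point d) → Carrier → Set
  Equidistant x s = ∀ i j → i ≢ j → sqDist (x i) (x j) ≡ s

  Equidistant-∘ : ∀ {d m n} {x : Fin m → Point d} {s} {f : Fin n → Fin m} →
    Equidistant x s → Injective _≡_ _≡_ f → Equidistant (x ∘ f) s
  Equidistant-∘ {f = f} x-eq f-inj i j i≢j = x-eq (f i) (f j) (i≢j ∘ f-inj)

  Equidistant⇒sqDist≡ : ∀ {d e m} {x : Fin m → Point d} {y : Fin m → Point e} {s} →
    Equidistant x s → Equidistant y s → ∀ i j → sqDist (x i) (x j) ≡ sqDist (y i) (y j)
  Equidistant⇒sqDist≡ {x = x} {y} x-eq y-eq i j with i ≟ j
  ... | yes refl = trans (sqDist-self (x i)) (sym (sqDist-self (y i)))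
  ... | no i≢j = trans (x-eq i j i≢j) (sym (y-eq i j i≢j))

  Equidistant⇒IsSqDiam : ∀ {d m} {x : Fin (suc (suc m)) → Point d} {s} →
    0# ≤ s → Equidistant x s → IsSqDiam x s
  Equidistant⇒IsSqDiam {x = x} {s} 0≤s x-eq =
    bounded , zero , suc zero , x-eq zero (suc zero) λ ()
    where
    bounded : ∀ i j → sqDist (x i) (x j) ≤ s
    bounded i j with i ≟ j
    ... | yes refl = subst (_≤ s) (sym (sqDist-self (x i))) 0≤s
    ... | no i≢j = inj₂ (x-eq i j i≢j)

  Equidistant⇒Injective : ∀ {d m} {x : Fin m → Point d} {s} →
    s ≢ 0# → Equidistant x s → Injective _≡_ _≈ₚ_ x
  Equidistant⇒Injective {x = x} s≢0 x-eq {i} {j} xi≈xj with i ≟ j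
  ... | yes i≡j = i≡j
  ... | no i≢j =
    ⊥-elim (s≢0 (trans (sym (x-eq i j i≢j)) (≈ₚ⇒sqDist≡0 {x = x i} {x j} xi≈xj)))

  -- halves has squared norm ½, which cancels the squared side 1 + 1 of the standard basis.
  standardSimplex : ∀ {m} → Point m → (N : ℕ) → Fin N → Point (N ℕ.* (2 ℕ.* m))
  standardSimplex w N i = basis i ⊗ (halves ⊗ w)

  standardSimplex-equidistant : ∀ {m} (w : Point m) N →
    Equidistant (standardSimplex w N) (sqNorm w)
  standardSimplex-equidistant {m} w N i j i≢j = begin
    sqDist (basis i ⊗ v) (basis j ⊗ v)          ≡⟨ sqDist-⊗ʳ (basis i) (basis j) v ⟩
    sqDist (basis i) (basis j) * sqNorm v       ≡⟨ cong₂ _*_ (sqDist-basis i≢j) (sqNorm-⊗ halves w) ⟩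
    (1# + 1#) * (sqNorm halves * sqNorm w)
      ≡⟨ cong (λ z → (1# + 1#) * (z * sqNorm w)) sqNorm-halves ⟩
    (1# + 1#) * (½ * sqNorm w)                  ≡⟨ *-assoc (1# + 1#) ½ (sqNorm w) ⟨
    ((1# + 1#) * ½) * sqNorm w                  ≡⟨ cong (_* sqNorm w) 2*½≡1 ⟩
    1# * sqNorm w                               ≡⟨ *-identityˡ (sqNorm w) ⟩
    sqNorm w                                    ∎
    where
    open ≡-Reasoning
    v : Point (2 ℕ.* m)
    v = halves ⊗ w

  point-diameterRamsey : ∀ {n} (p : Fin 1 → Point n) → DiameterRamsey p
  point-diameterRamsey p _ _ =
    _ , 1 , p , p-injective , sqDist (p zero) (p zero) , (diam , diam) ,
    λ _ → (λ i → i) , (λ i≡j → i≡j) , (λ { zero zero → refl }) , (λ _ _ → refl)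
    where
    p-injective : Injective _≡_ _≈ₚ_ p
    p-injective {zero} {zero} _ = refl
    diam : IsSqDiam p (sqDist (p zero) (p zero))
    diam = (λ { zero zero → inj₂ refl }) , zero , zero , refl

  equidistant⇒diameterRamsey : ∀ {n m k} (p : Fin (suc (suc k)) → Point n) (w : Point m) →
    Equidistant p (sqNorm w) → sqNorm w ≢ 0# → DiameterRamsey p
  equidistant⇒diameterRamsey {k = k} p w p-eq w≢0 r (s≤s (s≤s _)) =
    _ , N , e , Equidistant⇒Injective {x = e} w≢0 e-eq , sqNorm w ,
    (Equidistant⇒IsSqDiam {x = p} (sqNorm-nonneg w) p-eq ,
     Equidistant⇒IsSqDiam {x = e} (sqNorm-nonneg w) e-eq) ,
    ramsey
    where
    -- Matching on 2 ≤ r makes N reduce to the form suc (suc _) that Equidistant⇒IsSqDiam needs.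
    N = suc (r ℕ.* suc k)
    e = standardSimplex w N
    e-eq = standardSimplex-equidistant w N
    ramsey : RamseyFor p e r
    ramsey χ with f , f-injective , f-monochromatic ← pigeonhole (suc k) χ (n<1+n _) =
      f , f-injective , f-monochromatic ,
      Equidistant⇒sqDist≡ {x = e ∘ f} {p} (Equidistant-∘ {x = e} e-eq f-injective) p-eq

mainTheorem6 : (ℝ : RealField) (n k : ℕ) (p : Fin (suc k) → Euclid.Point ℝ n) →
    Euclid.RegularSimplex ℝ p → Euclid.DiameterRamsey ℝ p
mainTheorem6 ℝ n zero p _ = point-diameterRamsey ℝ p
mainTheorem6 ℝ n (suc k) p (independent , s , p-eq) =
  equidistant⇒diameterRamsey ℝ p edge (λ i j i≢j → trans (p-eq i j i≢j) s≡|edge|²) edge≢0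
  where
  open RealField ℝ
  open Euclid ℝ
  edge : Point n
  edge t = p zero t - p (suc zero) t
  s≡|edge|² : s ≡ sqNorm ℝ edge
  s≡|edge|² = sym (p-eq zero (suc zero) λ ())
  edge≢0 : sqNorm ℝ edge ≢ 0#
  edge≢0 = (λ ()) ∘ affinelyIndependent⇒injective ℝ {p = p} independent {zero} {suc zero}
                 ∘ sqDist≡0⇒≈ₚ ℝ
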